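{- For every integer $n\geq 3$, $$M^L(n) \geq \frac{3 \cdot 2^n}{3n-2},$$ where $M^L(n)$ denotes the minimum cardinality of a local identifying code in the binary $n$-dimensional hypercube.
   Context: The binary $n$-dimensional hypercube is the graph with vertex set $\{0,1\}^n$ in which two binary words are adjacent iff their Hamming distance is $1$. For a vertex $u$ of a graph, $N[u]$ is the closed neighbourhood (the vertex $u$ together with its neighbours). For a code (nonempty vertex subset) $C$, let $I_C(u)=N[u]\cap C$. A code $C$ is a covering code if $I_C(u)\neq\emptyset$ for every vertex $u$. A code $C$ is a local identifying code if it is a covering code and $I_C(u)\neq I_C(v)$ for every pair of adjacent vertices $u,v$. -}

module Defs where

open import Data.Bool using (Bool; true; false)
open import Data.Nat using (ℕ; zero; suc; _+_)
open import Data.Vec using (Vec; []; _∷_)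
open import Data.List using (List)
open import Data.List.Membership.Propositional using (_∈_)
open import Data.Product using (_×_)
open import Data.Sum using (_⊎_)
open import Data.Empty using (⊥)
open import Relation.Binary.PropositionalEquality using (_≡_)
open import Relation.Nullary using (¬_)
open import Function.Bundles using (_⇔_)

Word : ℕ → Set
Word n = Vec Bool n

bitDiff : Bool → Bool → ℕ
bitDiff true  true  = 0
bitDiff false false = 0
bitDiff true  false = 1
bitDiff false true  = 1

hamming : ∀ {n} → Word n → Word n → ℕ
hamming []       []       = 0
hamming (x ∷ xs) (y ∷ ys) = bitDiff x y + hamming xs ys

Adjacent : ∀ {n} → Word n → Word n → Set
Adjacent u v = hamming u v ≡ 1

InClosedNbhd : ∀ {n} → Word n → Word n → Set
InClosedNbhd u w = (w ≡ u) ⊎ Adjacent u w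

-- a code is a finite list of words without repetitions; its cardinality is its length
-- membership in I_C(u) = N[u] ∩ C
InI : ∀ {n} → List (Word n) → Word n → Word n → Set
InI C u w = InClosedNbhd u w × (w ∈ C)

Covered : ∀ {n} → List (Word n) → Word n → Set
Covered C u = ¬ (∀ w → ¬ InI C u w)

IsCovering : ∀ {n} → List (Word n) → Set
IsCovering C = ∀ u → Covered C u

Separated : ∀ {n} → List (Word n) → Word n → Word n → Set
Separated C u v = ¬ (∀ w → InI C u w ⇔ InI C v w)

IsLocalIdentifying : ∀ {n} → List (Word n) → Set
IsLocalIdentifying C = IsCovering C × (∀ u v → Adjacent u v → Separated C u v)

-- Discharging. Every vertex u hands the weight w(|I(u)|) to each codeword of I(u), where
-- w(1) = 6, w(2) = 3 and w(k) = 2 for k ≥ 3; since k·w(k) ≥ 6, a covering code receives at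
-- least 6·2^n in total. Local identification forbids a codeword c from collecting much:
-- if c has no codeword neighbour, every neighbour v of c must see a second codeword (else
-- I(v) = {c} = I(c)), so c collects at most 6 + 3n; if c has codeword neighbours, either it
-- has two of them, or its only one c' must see a further codeword d (else I(c) = I(c')), and
-- d also lies next to a second neighbour of c. Either way c collects at most 6n − 4.
-- As 6 + 3n ≤ 6n − 4 for n ≥ 4, this gives 6·2^n ≤ (6n − 4)|C|; for n = 3 it gives
-- 48 ≤ 15|C|, i.e. |C| ≥ 4.
module Submission where

open import Defs
open import Data.Bool using (Bool; true; false; not; _∧_; if_then_else_; T)
open import Data.Bool.Properties using (not-¬; T-∧) renaming (_≟_ to _≟ᵇ_)
open import Data.Nat using (ℕ; zero; suc; _+_; _*_; _^_; _∸_; _≤_; _≤′_; ≤′-refl; ≤′-step; _≤ᵇ_; _<ᵇ_; _≤?_; z≤n; s≤s)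
open import Data.Nat.Properties
open import Data.Nat.ListAction using (sum)
open import Data.Nat.Solver using (module +-*-Solver)
open import Data.Fin using (Fin; zero; suc)
open import Data.Fin.Properties using (any?) renaming (_≟_ to _≟ᶠ_)
open import Data.Vec using ([]; _∷_)
open import Data.Vec.Properties using (≡-dec; ∷-injectiveˡ; ∷-injectiveʳ)
open import Data.List using (List; []; _∷_; length; map)
open import Data.List.Membership.Propositional using (_∈_; _∉_)
open import Data.List.Relation.Unary.All using (All; []; _∷_) renaming (map to All-map)
open import Data.List.Relation.Unary.Any using (here; there)
open import Data.List.Relation.Unary.Unique.Propositional using (Unique; []; _∷_)
open import Data.Product using (_×_; _,_; proj₁; ∃)
open import Data.Sum using (_⊎_; inj₁; inj₂)
open import Data.Empty using (⊥-elim)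
open import Data.Unit using (tt)
open import Function using (_∘_)
open import Function.Bundles using (mk⇔; Equivalence)
open import Relation.Binary.Definitions using (DecidableEquality)
open import Relation.Binary.PropositionalEquality
open import Relation.Nullary using (Dec; yes; no; does; contradiction)
open import Relation.Nullary.Decidable using (_×-dec_; ¬?)
open +-*-Solver using (solve; _:+_; _:*_; _:=_; con)

flipAt : ∀ {n} → Fin n → Word n → Word n
flipAt zero    (x ∷ u) = not x ∷ u
flipAt (suc i) (x ∷ u) = x ∷ flipAt i u

flipAt-involutive : ∀ {n} (i : Fin n) (u : Word n) → flipAt i (flipAt i u) ≡ u
flipAt-involutive zero    (true  ∷ u) = refl
flipAt-involutive zero    (false ∷ u) = refl
flipAt-involutive (suc i) (x ∷ u)     = cong (x ∷_) (flipAt-involutive i u)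

flipAt-comm : ∀ {n} (i j : Fin n) (u : Word n) → flipAt i (flipAt j u) ≡ flipAt j (flipAt i u)
flipAt-comm zero    zero    u       = refl
flipAt-comm zero    (suc j) (x ∷ u) = refl
flipAt-comm (suc i) zero    (x ∷ u) = refl
flipAt-comm (suc i) (suc j) (x ∷ u) = cong (x ∷_) (flipAt-comm i j u)

flipAt-≢ : ∀ {n} (i : Fin n) (u : Word n) → flipAt i u ≢ u
flipAt-≢ zero    (x ∷ u) eq = not-¬ refl (sym (∷-injectiveˡ eq))
flipAt-≢ (suc i) (x ∷ u) eq = flipAt-≢ i u (∷-injectiveʳ eq)

flipAt-injectiveˡ : ∀ {n} (i j : Fin n) (u : Word n) → flipAt i u ≡ flipAt j u → i ≡ j
flipAt-injectiveˡ zero    zero    u       eq = refl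
flipAt-injectiveˡ zero    (suc j) (x ∷ u) eq = ⊥-elim (not-¬ refl (sym (∷-injectiveˡ eq)))
flipAt-injectiveˡ (suc i) zero    (x ∷ u) eq = ⊥-elim (not-¬ refl (∷-injectiveˡ eq))
flipAt-injectiveˡ (suc i) (suc j) (x ∷ u) eq = cong suc (flipAt-injectiveˡ i j u (∷-injectiveʳ eq))

flipAt-flipAt≡⇒≡ : ∀ {n} (i j : Fin n) (u : Word n) → flipAt i (flipAt j u) ≡ u → i ≡ j
flipAt-flipAt≡⇒≡ i j u eq = sym (flipAt-injectiveˡ j i u (begin
  flipAt j u                       ≡⟨ sym (flipAt-involutive i (flipAt j u)) ⟩
  flipAt i (flipAt i (flipAt j u)) ≡⟨ cong (flipAt i) eq ⟩
  flipAt i u                       ∎))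
  where open ≡-Reasoning

bitDiff-refl : ∀ x → bitDiff x x ≡ 0
bitDiff-refl true  = refl
bitDiff-refl false = refl

bitDiff-sym : ∀ x y → bitDiff x y ≡ bitDiff y x
bitDiff-sym true  true  = refl
bitDiff-sym true  false = refl
bitDiff-sym false true  = refl
bitDiff-sym false false = refl

hamming-refl : ∀ {n} (u : Word n) → hamming u u ≡ 0
hamming-refl []      = refl
hamming-refl (x ∷ u) = cong₂ _+_ (bitDiff-refl x) (hamming-refl u)

hamming-sym : ∀ {n} (u v : Word n) → hamming u v ≡ hamming v u
hamming-sym []      []      = refl
hamming-sym (x ∷ u) (y ∷ v) = cong₂ _+_ (bitDiff-sym x y) (hamming-sym u v)

hamming≡0⇒≡ : ∀ {n} (u v : Word n) → hamming u v ≡ 0 → u ≡ v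
hamming≡0⇒≡ []          []          _  = refl
hamming≡0⇒≡ (true  ∷ u) (true  ∷ v) eq = cong (true  ∷_) (hamming≡0⇒≡ u v eq)
hamming≡0⇒≡ (false ∷ u) (false ∷ v) eq = cong (false ∷_) (hamming≡0⇒≡ u v eq)

adjacent-flipAt : ∀ {n} (i : Fin n) (u : Word n) → Adjacent u (flipAt i u)
adjacent-flipAt zero    (true  ∷ u) = cong suc (hamming-refl u)
adjacent-flipAt zero    (false ∷ u) = cong suc (hamming-refl u)
adjacent-flipAt (suc i) (x ∷ u)     = trans (cong (_+ _) (bitDiff-refl x)) (adjacent-flipAt i u)

flipAt-adjacent : ∀ {n} (i : Fin n) (u : Word n) → Adjacent (flipAt i u) u
flipAt-adjacent i u = trans (hamming-sym (flipAt i u) u) (adjacent-flipAt i u)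

adjacent⇒flipAt : ∀ {n} (u v : Word n) → Adjacent u v → ∃ λ i → v ≡ flipAt i u
adjacent⇒flipAt []          []          ()
adjacent⇒flipAt (true  ∷ u) (true  ∷ v) adj = let i , eq = adjacent⇒flipAt u v adj in suc i , cong (true  ∷_) eq
adjacent⇒flipAt (false ∷ u) (false ∷ v) adj = let i , eq = adjacent⇒flipAt u v adj in suc i , cong (false ∷_) eq
adjacent⇒flipAt (true  ∷ u) (false ∷ v) adj = zero , cong (false ∷_) (sym (hamming≡0⇒≡ u v (suc-injective adj)))
adjacent⇒flipAt (false ∷ u) (true  ∷ v) adj = zero , cong (true  ∷_) (sym (hamming≡0⇒≡ u v (suc-injective adj)))

closedNbhd⇒≡⊎flipAt : ∀ {n} {u w : Word n} → InClosedNbhd u w → w ≡ u ⊎ ∃ λ i → w ≡ flipAt i u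
closedNbhd⇒≡⊎flipAt           (inj₁ eq)  = inj₁ eq
closedNbhd⇒≡⊎flipAt {u = u} {w} (inj₂ adj) = inj₂ (adjacent⇒flipAt u w adj)

_≟ʷ_ : ∀ {n} → DecidableEquality (Word n)
_≟ʷ_ = ≡-dec _≟ᵇ_

_∈?_ : ∀ {n} (w : Word n) (C : List (Word n)) → Dec (w ∈ C)
w ∈? C = Membership._∈?_ _≟ʷ_ w C
  where import Data.List.Membership.DecPropositional as Membership

InI-self : ∀ {n} {C : List (Word n)} {u : Word n} → u ∈ C → InI C u u
InI-self u∈C = inj₁ refl , u∈C

InI-flipAt : ∀ {n} {C : List (Word n)} (i : Fin n) {u : Word n} → flipAt i u ∈ C → InI C u (flipAt i u)
InI-flipAt i {u} v∈C = inj₂ (adjacent-flipAt i u) , v∈C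

InI-neighbour : ∀ {n} {C : List (Word n)} (i : Fin n) {u : Word n} → u ∈ C → InI C (flipAt i u) u
InI-neighbour i {u} u∈C = inj₂ (flipAt-adjacent i u) , u∈C

-- N[u] ∩ N[flipAt i u] = {u, flipAt i u}, so when I(u) ⊆ I(flipAt i u) the codeword telling
-- the two apart is a further neighbour of flipAt i u.
separatingCodeword : ∀ {n} {C : List (Word n)} → (∀ u v → Adjacent u v → Separated C u v) →
  (i : Fin n) (u : Word n) → (∀ w → InI C u w → InI C (flipAt i u) w) →
  ∃ λ m → m ≢ i × flipAt m (flipAt i u) ∈ C
separatingCodeword {C = C} separates i u I⊆ with any? (λ m → ¬? (m ≟ᶠ i) ×-dec (flipAt m (flipAt i u) ∈? C))
... | yes found = found
... | no none = ⊥-elim (separates u (flipAt i u) (adjacent-flipAt i u) (λ w → mk⇔ (I⊆ w) (I⊇ w)))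
  where
    I⊇ : ∀ w → InI C (flipAt i u) w → InI C u w
    I⊇ w (w∼v , w∈C) with closedNbhd⇒≡⊎flipAt w∼v
    ... | inj₁ refl = InI-flipAt i w∈C
    ... | inj₂ (k , refl) with k ≟ᶠ i
    ...   | yes refl = inj₁ (flipAt-involutive i u) , w∈C
    ...   | no k≢i = ⊥-elim (none (k , k≢i , w∈C))

indicator : Bool → ℕ
indicator b = if b then 1 else 0

indicator-mono : ∀ a b → (T a → T b) → indicator a ≤ indicator b
indicator-mono false b     _   = z≤n
indicator-mono true  true  _   = ≤-refl
indicator-mono true  false a⇒b = ⊥-elim (a⇒b tt)

countᵇ : ∀ {A : Set} → (A → Bool) → List A → ℕ
countᵇ p []       = 0
countᵇ p (x ∷ xs) = indicator (p x) + countᵇ p xs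

countᵇ-mono : ∀ {A : Set} (p q : A → Bool) (xs : List A) → (∀ x → T (p x) → T (q x)) →
  countᵇ p xs ≤ countᵇ q xs
countᵇ-mono p q []       p⇒q = z≤n
countᵇ-mono p q (x ∷ xs) p⇒q = +-mono-≤ (indicator-mono (p x) (q x) (p⇒q x)) (countᵇ-mono p q xs p⇒q)

module _ {A : Set} (_≟_ : DecidableEquality A) where

  _without_ : (A → Bool) → A → A → Bool
  (p without a) x = p x ∧ not (does (x ≟ a))

  countᵇ-without : ∀ (p : A → Bool) (xs : List A) {a} → a ∈ xs → T (p a) →
    suc (countᵇ (p without a) xs) ≤ countᵇ p xs
  countᵇ-without p (a ∷ xs) (here refl) pa with p a | a ≟ a
  ... | true | yes _ = s≤s (countᵇ-mono (p without a) p xs (λ x → proj₁ ∘ Equivalence.to T-∧))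
  ... | _    | no a≢a = contradiction refl a≢a
  countᵇ-without p (x ∷ xs) (there a∈xs) pa = begin
    suc (indicator ((p without _) x) + countᵇ (p without _) xs) ≡⟨ sym (+-suc _ _) ⟩
    indicator ((p without _) x) + suc (countᵇ (p without _) xs)
      ≤⟨ +-mono-≤ (indicator-mono _ (p x) (proj₁ ∘ Equivalence.to T-∧)) (countᵇ-without p xs a∈xs pa) ⟩
    indicator (p x) + countᵇ p xs ∎
    where open ≤-Reasoning

  without-keeps : ∀ (p : A → Bool) {a z} → z ≢ a → T (p z) → T (p z ∧ not (does (z ≟ a)))
  without-keeps p {a} {z} z≢a pz with z ≟ a
  ... | yes z≡a = contradiction z≡a z≢a
  ... | no _    = Equivalence.from T-∧ (pz , tt)

  length≤countᵇ : ∀ (p : A → Bool) (xs : List A) {ys : List A} → Unique ys →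
    All (λ y → y ∈ xs × T (p y)) ys → length ys ≤ countᵇ p xs
  length≤countᵇ p xs []           []                   = z≤n
  length≤countᵇ p xs (a≢ys ∷ !ys) ((a∈xs , pa) ∷ ys⊆) =
    ≤-trans (s≤s (length≤countᵇ (p without _) xs !ys (kept a≢ys ys⊆))) (countᵇ-without p xs a∈xs pa)
    where
      kept : ∀ {a zs} → All (a ≢_) zs → All (λ z → z ∈ xs × T (p z)) zs →
        All (λ z → z ∈ xs × T ((p without a) z)) zs
      kept []           []                   = []
      kept (a≢z ∷ a≢zs) ((z∈xs , pz) ∷ zs⊆) = (z∈xs , without-keeps p (a≢z ∘ sym) pz) ∷ kept a≢zs zs⊆

inClosedNbhdᵇ : ∀ {n} → Word n → Word n → Bool
inClosedNbhdᵇ u w = hamming u w ≤ᵇ 1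

closedNbhd⇒inClosedNbhdᵇ : ∀ {n} {u w : Word n} → InClosedNbhd u w → T (inClosedNbhdᵇ u w)
closedNbhd⇒inClosedNbhdᵇ {u = u} (inj₁ refl) rewrite hamming-refl u = tt
closedNbhd⇒inClosedNbhdᵇ         (inj₂ adj)  rewrite adj            = tt

traceSize : ∀ {n} → List (Word n) → Word n → ℕ
traceSize C u = countᵇ (inClosedNbhdᵇ u) C

length≤traceSize : ∀ {n} {C : List (Word n)} {u : Word n} {ws : List (Word n)} →
  Unique ws → All (InI C u) ws → length ws ≤ traceSize C u
length≤traceSize {C = C} {u} !ws ws⊆ =
  length≤countᵇ _≟ʷ_ (inClosedNbhdᵇ u) C !ws (All-map (λ (w∼u , w∈C) → w∈C , closedNbhd⇒inClosedNbhdᵇ w∼u) ws⊆)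

covering⇒traceSize≥1 : ∀ {n} {C : List (Word n)} → IsCovering C → ∀ u → 1 ≤ traceSize C u
covering⇒traceSize≥1 {C = C} covering u with 1 ≤? traceSize C u
... | yes 1≤size = 1≤size
... | no  1≰size = ⊥-elim (covering u (λ w w∈I → 1≰size (length≤traceSize ([] ∷ []) (w∈I ∷ []))))

weight : ℕ → ℕ
weight 0                   = 6
weight 1                   = 6
weight 2                   = 3
weight (suc (suc (suc _))) = 2

weight-suc : ∀ k → weight (suc k) ≤ weight k
weight-suc 0                   = ≤-refl
weight-suc 1                   = m≤m+n 3 3
weight-suc 2                   = n≤1+n 2
weight-suc (suc (suc (suc _))) = ≤-refl

weight-antitone : ∀ {k l} → k ≤ l → weight l ≤ weight k
weight-antitone = antitone′ ∘ ≤⇒≤′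
  where
    antitone′ : ∀ {k l} → k ≤′ l → weight l ≤ weight k
    antitone′ ≤′-refl          = ≤-refl
    antitone′ (≤′-step k≤′l) = ≤-trans (weight-suc _) (antitone′ k≤′l)

weight≤6 : ∀ k → weight k ≤ 6
weight≤6 k = weight-antitone {0} z≤n

6≤k*weight : ∀ k → 1 ≤ k → 6 ≤ k * weight k
6≤k*weight 1                   _ = ≤-refl
6≤k*weight 2                   _ = ≤-refl
6≤k*weight (suc (suc (suc k))) _ = m≤m+n 6 (k * 2)

sumFin : ∀ n → (Fin n → ℕ) → ℕ
sumFin zero    h = 0
sumFin (suc n) h = h zero + sumFin n (h ∘ suc)

sumFin-≤ : ∀ n (h : Fin n → ℕ) b → (∀ i → h i ≤ b) → sumFin n h ≤ n * b
sumFin-≤ zero    h b h≤b = z≤n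
sumFin-≤ (suc n) h b h≤b = +-mono-≤ (h≤b zero) (sumFin-≤ n (h ∘ suc) b (h≤b ∘ suc))

sumFin-slack : ∀ n (h : Fin n → ℕ) b (j : Fin n) x → (∀ i → h i ≤ b) → h j + x ≤ b →
  sumFin n h + x ≤ n * b
sumFin-slack (suc n) h b zero x h≤b hj+x≤b = begin
  h zero + S + x   ≡⟨ +-assoc (h zero) S x ⟩
  h zero + (S + x) ≡⟨ cong (h zero +_) (+-comm S x) ⟩
  h zero + (x + S) ≡⟨ sym (+-assoc (h zero) x S) ⟩
  h zero + x + S   ≤⟨ +-mono-≤ hj+x≤b (sumFin-≤ n (h ∘ suc) b (h≤b ∘ suc)) ⟩
  b + n * b        ∎
  where open ≤-Reasoning
        S : ℕ
        S = sumFin n (h ∘ suc)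
sumFin-slack (suc n) h b (suc j) x h≤b hj+x≤b = begin
  h zero + S + x   ≡⟨ +-assoc (h zero) S x ⟩
  h zero + (S + x) ≤⟨ +-mono-≤ (h≤b zero) (sumFin-slack n (h ∘ suc) b j x (h≤b ∘ suc) hj+x≤b) ⟩
  b + n * b        ∎
  where open ≤-Reasoning
        S : ℕ
        S = sumFin n (h ∘ suc)

sumFin-slack₂ : ∀ n (h : Fin n → ℕ) b (j k : Fin n) x y → j ≢ k → (∀ i → h i ≤ b) →
  h j + x ≤ b → h k + y ≤ b → sumFin n h + x + y ≤ n * b
sumFin-slack₂ (suc n) h b zero zero x y j≢k _ _ _ = contradiction refl j≢k
sumFin-slack₂ (suc n) h b zero (suc k) x y _ h≤b hj+x≤b hk+y≤b = begin
  h zero + S + x + y     ≡⟨ solve 4 (λ a s x y → a :+ s :+ x :+ y := (a :+ x) :+ (s :+ y)) refl (h zero) S x y ⟩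
  (h zero + x) + (S + y) ≤⟨ +-mono-≤ hj+x≤b (sumFin-slack n (h ∘ suc) b k y (h≤b ∘ suc) hk+y≤b) ⟩
  b + n * b              ∎
  where open ≤-Reasoning
        S : ℕ
        S = sumFin n (h ∘ suc)
sumFin-slack₂ (suc n) h b (suc j) zero x y _ h≤b hj+x≤b hk+y≤b = begin
  h zero + S + x + y     ≡⟨ solve 4 (λ a s x y → a :+ s :+ x :+ y := (a :+ y) :+ (s :+ x)) refl (h zero) S x y ⟩
  (h zero + y) + (S + x) ≤⟨ +-mono-≤ hk+y≤b (sumFin-slack n (h ∘ suc) b j x (h≤b ∘ suc) hj+x≤b) ⟩
  b + n * b              ∎
  where open ≤-Reasoning
        S : ℕ
        S = sumFin n (h ∘ suc)
sumFin-slack₂ (suc n) h b (suc j) (suc k) x y j≢k h≤b hj+x≤b hk+y≤b = begin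
  h zero + S + x + y     ≡⟨ solve 4 (λ a s x y → a :+ s :+ x :+ y := a :+ (s :+ x :+ y)) refl (h zero) S x y ⟩
  h zero + (S + x + y)   ≤⟨ +-mono-≤ (h≤b zero)
                              (sumFin-slack₂ n (h ∘ suc) b j k x y (j≢k ∘ cong suc) (h≤b ∘ suc) hj+x≤b hk+y≤b) ⟩
  b + n * b              ∎
  where open ≤-Reasoning
        S : ℕ
        S = sumFin n (h ∘ suc)

received : ∀ {n} → List (Word n) → Word n → ℕ
received {n} C c = weight (traceSize C c) + sumFin n (λ i → weight (traceSize C (flipAt i c)))

module _ {n} {C : List (Word n)} {c : Word n} (c∈C : c ∈ C) where

  private
    incoming : Fin n → ℕ
    incoming i = weight (traceSize C (flipAt i c))

  isolated⇒I⊆I-flipAt : (∀ i → flipAt i c ∉ C) → ∀ i w → InI C c w → InI C (flipAt i c) w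
  isolated⇒I⊆I-flipAt isolated i w (w∼c , w∈C) with closedNbhd⇒≡⊎flipAt w∼c
  ... | inj₁ refl       = InI-neighbour i w∈C
  ... | inj₂ (k , refl) = contradiction w∈C (isolated k)

  lone-neighbour⇒I⊆I-flipAt : ∀ {j} → flipAt j c ∈ C → (∀ k → k ≢ j → flipAt k c ∉ C) →
    ∀ w → InI C c w → InI C (flipAt j c) w
  lone-neighbour⇒I⊆I-flipAt {j} cj∈C alone w (w∼c , w∈C) with closedNbhd⇒≡⊎flipAt w∼c
  ... | inj₁ refl = InI-neighbour j w∈C
  ... | inj₂ (k , refl) with k ≟ᶠ j
  ...   | yes refl = InI-self w∈C
  ...   | no k≢j   = contradiction w∈C (alone k k≢j)

  received-isolated : (∀ u v → Adjacent u v → Separated C u v) → (∀ i → flipAt i c ∉ C) →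
    received C c ≤ 6 + 3 * n
  received-isolated separates isolated = begin
    weight (traceSize C c) + sumFin n incoming ≤⟨ +-mono-≤ (weight≤6 _) (sumFin-≤ n incoming 3 incoming≤3) ⟩
    6 + n * 3                                  ≡⟨ cong (6 +_) (*-comm n 3) ⟩
    6 + 3 * n                                  ∎
    where
      open ≤-Reasoning
      incoming≤3 : ∀ i → incoming i ≤ 3
      incoming≤3 i with separatingCodeword separates i c (isolated⇒I⊆I-flipAt isolated i)
      ... | m , m≢i , d∈C = weight-antitone (length≤traceSize
            (((λ c≡d → m≢i (flipAt-flipAt≡⇒≡ m i c (sym c≡d))) ∷ []) ∷ [] ∷ [])
            (InI-neighbour i c∈C ∷ InI-flipAt m d∈C ∷ []))

  received-two-neighbours : ∀ {j k} → flipAt j c ∈ C → flipAt k c ∈ C → j ≢ k →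
    received C c + 4 ≤ 6 * n
  received-two-neighbours {j} {k} cj∈C ck∈C j≢k = begin
    weight (traceSize C c) + S + 4 ≤⟨ +-monoˡ-≤ 4 (+-monoˡ-≤ S (weight-antitone three-at-c)) ⟩
    2 + S + 4                      ≡⟨ solve 1 (λ s → con 2 :+ s :+ con 4 := s :+ con 3 :+ con 3) refl S ⟩
    S + 3 + 3                      ≤⟨ sumFin-slack₂ n incoming 6 j k 3 3 j≢k (λ i → weight≤6 _)
                                        (+-monoˡ-≤ 3 (two-at j cj∈C)) (+-monoˡ-≤ 3 (two-at k ck∈C)) ⟩
    n * 6                          ≡⟨ *-comm n 6 ⟩
    6 * n                          ∎
    where
      open ≤-Reasoning
      S : ℕ
      S = sumFin n incoming
      three-at-c : 3 ≤ traceSize C c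
      three-at-c = length≤traceSize
        ((flipAt-≢ j c ∘ sym ∷ flipAt-≢ k c ∘ sym ∷ []) ∷ ((j≢k ∘ flipAt-injectiveˡ j k c) ∷ []) ∷ [] ∷ [])
        (InI-self c∈C ∷ InI-flipAt j cj∈C ∷ InI-flipAt k ck∈C ∷ [])
      two-at : ∀ i → flipAt i c ∈ C → incoming i ≤ 3
      two-at i ci∈C = weight-antitone (length≤traceSize
        (((flipAt-≢ i c ∘ sym) ∷ []) ∷ [] ∷ []) (InI-neighbour i c∈C ∷ InI-self ci∈C ∷ []))

  received-lone-neighbour : (∀ u v → Adjacent u v → Separated C u v) → ∀ {j} → flipAt j c ∈ C →
    (∀ k → k ≢ j → flipAt k c ∉ C) → received C c + 4 ≤ 6 * n
  received-lone-neighbour separates {j} cj∈C alone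
    with separatingCodeword separates j c (lone-neighbour⇒I⊆I-flipAt cj∈C alone)
  ... | m , m≢j , d∈C = begin
    weight (traceSize C c) + S + 4 ≤⟨ +-monoˡ-≤ 4 (+-monoˡ-≤ S (weight-antitone two-at-c)) ⟩
    3 + S + 4                      ≡⟨ solve 1 (λ s → con 3 :+ s :+ con 4 := s :+ con 4 :+ con 3) refl S ⟩
    S + 4 + 3                      ≤⟨ sumFin-slack₂ n incoming 6 j m 4 3 (m≢j ∘ sym) (λ i → weight≤6 _)
                                        (+-monoˡ-≤ 4 (weight-antitone three-at-cj))
                                        (+-monoˡ-≤ 3 (weight-antitone two-at-cm)) ⟩
    n * 6                          ≡⟨ *-comm n 6 ⟩
    6 * n                          ∎
    where
      open ≤-Reasoning
      S : ℕ
      S = sumFin n incoming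
      cj d : Word n
      cj = flipAt j c
      d  = flipAt m cj
      c≢d : c ≢ d
      c≢d c≡d = m≢j (flipAt-flipAt≡⇒≡ m j c (sym c≡d))
      d≡ : d ≡ flipAt j (flipAt m c)
      d≡ = flipAt-comm m j c
      two-at-c : 2 ≤ traceSize C c
      two-at-c = length≤traceSize
        (((flipAt-≢ j c ∘ sym) ∷ []) ∷ [] ∷ []) (InI-self c∈C ∷ InI-flipAt j cj∈C ∷ [])
      three-at-cj : 3 ≤ traceSize C cj
      three-at-cj = length≤traceSize
        ((flipAt-≢ j c ∷ (flipAt-≢ m cj ∘ sym) ∷ []) ∷ (c≢d ∷ []) ∷ [] ∷ [])
        (InI-self cj∈C ∷ InI-neighbour j c∈C ∷ InI-flipAt m d∈C ∷ [])
      two-at-cm : 2 ≤ traceSize C (flipAt m c)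
      two-at-cm = length≤traceSize ((c≢d ∷ []) ∷ [] ∷ [])
        (InI-neighbour m c∈C ∷ subst (InI C (flipAt m c)) (sym d≡) (InI-flipAt j (subst (_∈ C) d≡ d∈C)) ∷ [])

received-bound : ∀ {n} {C : List (Word n)} {c : Word n} → IsLocalIdentifying C → c ∈ C →
  received C c + 4 ≤ 6 * n ⊎ received C c ≤ 6 + 3 * n
received-bound {C = C} {c} (_ , separates) c∈C with any? (λ j → flipAt j c ∈? C)
... | no none = inj₂ (received-isolated c∈C separates (λ j cj∈C → none (j , cj∈C)))
... | yes (j , cj∈C) with any? (λ k → ¬? (k ≟ᶠ j) ×-dec (flipAt k c ∈? C))
...   | yes (k , k≢j , ck∈C) = inj₁ (received-two-neighbours c∈C cj∈C ck∈C (k≢j ∘ sym))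
...   | no none              = inj₁ (received-lone-neighbour c∈C separates cj∈C (λ k k≢j ck∈C → none (k , k≢j , ck∈C)))

sumWords : ∀ n → (Word n → ℕ) → ℕ
sumWords zero    g = g []
sumWords (suc n) g = sumWords n (g ∘ (true ∷_)) + sumWords n (g ∘ (false ∷_))

sumWords-mono : ∀ n {g h : Word n → ℕ} → (∀ u → g u ≤ h u) → sumWords n g ≤ sumWords n h
sumWords-mono zero    g≤h = g≤h []
sumWords-mono (suc n) g≤h = +-mono-≤ (sumWords-mono n (g≤h ∘ (true ∷_))) (sumWords-mono n (g≤h ∘ (false ∷_)))

sumWords-const : ∀ n k → sumWords n (λ _ → k) ≡ k * 2 ^ n
sumWords-const zero    k = sym (*-identityʳ k)
sumWords-const (suc n) k = begin
  sumWords n (λ _ → k) + sumWords n (λ _ → k) ≡⟨ cong₂ _+_ (sumWords-const n k) (sumWords-const n k) ⟩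
  k * 2 ^ n + k * 2 ^ n                       ≡⟨ solve 2 (λ k p → k :* p :+ k :* p := k :* (con 2 :* p)) refl k (2 ^ n) ⟩
  k * (2 * 2 ^ n)                             ∎
  where open ≡-Reasoning

-- `h <ᵇ 1` tests h ≡ 0, and `suc h ≤ᵇ 1` reduces to `h <ᵇ 1`
sumWords-point : ∀ n (c : Word n) (g : Word n → ℕ) →
  sumWords n (λ u → if hamming u c <ᵇ 1 then g u else 0) ≡ g c
sumWords-point zero    []          g = refl
sumWords-point (suc n) (true  ∷ c) g = begin
  sumWords n _ + sumWords n (λ _ → 0) ≡⟨ cong₂ _+_ (sumWords-point n c (g ∘ (true ∷_))) (sumWords-const n 0) ⟩
  g (true ∷ c) + 0                    ≡⟨ +-identityʳ _ ⟩
  g (true ∷ c)                        ∎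
  where open ≡-Reasoning
sumWords-point (suc n) (false ∷ c) g =
  cong₂ _+_ (sumWords-const n 0) (sumWords-point n c (g ∘ (false ∷_)))

sumWords-closedNbhd : ∀ n (c : Word n) (g : Word n → ℕ) →
  sumWords n (λ u → if inClosedNbhdᵇ u c then g u else 0) ≡ g c + sumFin n (λ i → g (flipAt i c))
sumWords-closedNbhd zero    []          g = sym (+-identityʳ _)
sumWords-closedNbhd (suc n) (true  ∷ c) g = begin
  sumWords n _ + sumWords n _ ≡⟨ cong₂ _+_ (sumWords-closedNbhd n c (g ∘ (true ∷_))) (sumWords-point n c (g ∘ (false ∷_))) ⟩
  (a + S) + b                 ≡⟨ solve 3 (λ a s b → (a :+ s) :+ b := a :+ (b :+ s)) refl a S b ⟩
  a + (b + S)                 ∎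
  where
    open ≡-Reasoning
    a b S : ℕ
    a = g (true ∷ c)
    b = g (false ∷ c)
    S = sumFin n (λ i → g (true ∷ flipAt i c))
sumWords-closedNbhd (suc n) (false ∷ c) g = begin
  sumWords n _ + sumWords n _ ≡⟨ cong₂ _+_ (sumWords-point n c (g ∘ (true ∷_))) (sumWords-closedNbhd n c (g ∘ (false ∷_))) ⟩
  b + (a + S)                 ≡⟨ solve 3 (λ a s b → b :+ (a :+ s) := a :+ (b :+ s)) refl a S b ⟩
  a + (b + S)                 ∎
  where
    open ≡-Reasoning
    a b S : ℕ
    a = g (false ∷ c)
    b = g (true ∷ c)
    S = sumFin n (λ i → g (false ∷ flipAt i c))

sum-map-+ : ∀ {A : Set} (xs : List A) (g h : A → ℕ) →
  sum (map (λ x → g x + h x) xs) ≡ sum (map g xs) + sum (map h xs)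
sum-map-+ []       g h = refl
sum-map-+ (x ∷ xs) g h = begin
  g x + h x + sum (map (λ x → g x + h x) xs)   ≡⟨ cong (g x + h x +_) (sum-map-+ xs g h) ⟩
  g x + h x + (sum (map g xs) + sum (map h xs)) ≡⟨ solve 4 (λ a b s t → a :+ b :+ (s :+ t) := (a :+ s) :+ (b :+ t))
                                                      refl (g x) (h x) (sum (map g xs)) (sum (map h xs)) ⟩
  g x + sum (map g xs) + (h x + sum (map h xs)) ∎
  where open ≡-Reasoning

sum-map-≤ : ∀ {A : Set} (xs : List A) (h : A → ℕ) b → (∀ x → x ∈ xs → h x ≤ b) →
  sum (map h xs) ≤ length xs * b
sum-map-≤ []       h b h≤b = z≤n
sum-map-≤ (x ∷ xs) h b h≤b = +-mono-≤ (h≤b x (here refl)) (sum-map-≤ xs h b (λ y → h≤b y ∘ there))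

sum-map-if : ∀ {A : Set} (p : A → Bool) k (xs : List A) →
  sum (map (λ x → if p x then k else 0) xs) ≡ countᵇ p xs * k
sum-map-if p k []       = refl
sum-map-if p k (x ∷ xs) with p x
... | true  = cong (k +_) (sum-map-if p k xs)
... | false = sum-map-if p k xs

sumWords-sum-comm : ∀ n {A : Set} (xs : List A) (t : Word n → A → ℕ) →
  sumWords n (λ u → sum (map (t u) xs)) ≡ sum (map (λ x → sumWords n (λ u → t u x)) xs)
sumWords-sum-comm zero    xs t = refl
sumWords-sum-comm (suc n) xs t = begin
  sumWords n (λ u → sum (map (t (true ∷ u)) xs)) + sumWords n (λ u → sum (map (t (false ∷ u)) xs))
    ≡⟨ cong₂ _+_ (sumWords-sum-comm n xs (t ∘ (true ∷_))) (sumWords-sum-comm n xs (t ∘ (false ∷_))) ⟩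
  sum (map (λ x → sumWords n (λ u → t (true ∷ u) x)) xs) + sum (map (λ x → sumWords n (λ u → t (false ∷ u) x)) xs)
    ≡⟨ sym (sum-map-+ xs _ _) ⟩
  sum (map (λ x → sumWords (suc n) (λ u → t u x)) xs) ∎
  where open ≡-Reasoning

discharging : ∀ {n} {C : List (Word n)} → IsCovering C → ∀ b → (∀ c → c ∈ C → received C c ≤ b) →
  6 * 2 ^ n ≤ length C * b
discharging {n} {C} covering b received≤b = begin
  6 * 2 ^ n                                   ≡⟨ sym (sumWords-const n 6) ⟩
  sumWords n (λ _ → 6)                        ≤⟨ sumWords-mono n handed-out≥6 ⟩
  sumWords n (λ u → sum (map (handOut u) C))  ≡⟨ sumWords-sum-comm n C handOut ⟩
  sum (map (λ c → sumWords n (λ u → handOut u c)) C)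
    ≤⟨ sum-map-≤ C _ b (λ c c∈C → ≤-trans (≤-reflexive (sumWords-closedNbhd n c (weight ∘ traceSize C)))
                                          (received≤b c c∈C)) ⟩
  length C * b                                ∎
  where
    open ≤-Reasoning
    handOut : Word n → Word n → ℕ
    handOut u c = if inClosedNbhdᵇ u c then weight (traceSize C u) else 0
    handed-out≥6 : ∀ u → 6 ≤ sum (map (handOut u) C)
    handed-out≥6 u = ≤-trans (6≤k*weight _ (covering⇒traceSize≥1 covering u))
                             (≤-reflexive (sym (sum-map-if (inClosedNbhdᵇ u) _ C)))

3n∸2+2≡3n : ∀ n → 1 ≤ n → 3 * n ∸ 2 + 2 ≡ 3 * n
3n∸2+2≡3n n 1≤n = m∸n+n≡m (≤-trans (n≤1+n 2) (*-monoʳ-≤ 3 1≤n))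

received-bound≤15 : ∀ r → r + 4 ≤ 6 * 3 ⊎ r ≤ 6 + 3 * 3 → r ≤ 15
received-bound≤15 r (inj₁ r+4≤18) = ≤-trans (+-cancelʳ-≤ 4 r 14 r+4≤18) (n≤1+n 14)
received-bound≤15 r (inj₂ r≤15)   = r≤15

received-bound≤2[3n∸2] : ∀ n r → 4 ≤ n → r + 4 ≤ 6 * n ⊎ r ≤ 6 + 3 * n → r ≤ 2 * (3 * n ∸ 2)
received-bound≤2[3n∸2] n r 4≤n (inj₁ r+4≤6n) = +-cancelʳ-≤ 4 r (2 * m) (begin
  r + 4           ≤⟨ r+4≤6n ⟩
  6 * n           ≡⟨ *-assoc 2 3 n ⟩
  2 * (3 * n)     ≡⟨ cong (2 *_) (sym (3n∸2+2≡3n n (≤-trans (s≤s z≤n) 4≤n))) ⟩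
  2 * (m + 2)     ≡⟨ solve 1 (λ m → con 2 :* (m :+ con 2) := con 2 :* m :+ con 4) refl m ⟩
  2 * m + 4       ∎)
  where open ≤-Reasoning
        m : ℕ
        m = 3 * n ∸ 2
received-bound≤2[3n∸2] n r 4≤n (inj₂ r≤6+3n) = begin
  r           ≤⟨ r≤6+3n ⟩
  6 + 3 * n   ≡⟨ cong (6 +_) (sym (3n∸2+2≡3n n (≤-trans (s≤s z≤n) 4≤n))) ⟩
  6 + (m + 2) ≡⟨ solve 1 (λ m → con 6 :+ (m :+ con 2) := con 8 :+ m) refl m ⟩
  8 + m       ≤⟨ +-monoˡ-≤ m 8≤m ⟩
  m + m       ≡⟨ cong (m +_) (sym (+-identityʳ m)) ⟩
  2 * m       ∎
  where
    open ≤-Reasoning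
    m : ℕ
    m = 3 * n ∸ 2
    8≤m : 8 ≤ m
    8≤m = +-cancelʳ-≤ 2 8 m (begin
      10     ≤⟨ m≤m+n 10 2 ⟩
      3 * 4  ≤⟨ *-monoʳ-≤ 3 4≤n ⟩
      3 * n  ≡⟨ sym (3n∸2+2≡3n n (≤-trans (s≤s z≤n) 4≤n)) ⟩
      m + 2  ∎)

mainTheorem1 : (n : ℕ) → 3 ≤ n → (C : List (Word n)) → Unique C →
    IsLocalIdentifying C → 3 * 2 ^ n ≤ (3 * n ∸ 2) * length C
mainTheorem1 1 (s≤s ())
mainTheorem1 2 (s≤s (s≤s ()))
mainTheorem1 3 _ C _ localId@(covering , _) = begin
  24            ≤⟨ m≤m+n 24 4 ⟩
  7 * 4         ≤⟨ *-monoʳ-≤ 7 (*-cancelʳ-< 15 3 (length C) (≤-trans (m≤m+n 46 2) 48≤15|C|)) ⟩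
  7 * length C  ∎
  where
    open ≤-Reasoning
    48≤15|C| : 48 ≤ length C * 15
    48≤15|C| = discharging covering 15 (λ c c∈C → received-bound≤15 _ (received-bound localId c∈C))
mainTheorem1 n@(suc (suc (suc (suc _)))) _ C _ localId@(covering , _) = *-cancelˡ-≤ 2 (begin
  2 * (3 * 2 ^ n)  ≡⟨ sym (*-assoc 2 3 (2 ^ n)) ⟩
  6 * 2 ^ n        ≤⟨ discharging covering (2 * m) (λ c c∈C →
                        received-bound≤2[3n∸2] n _ (s≤s (s≤s (s≤s (s≤s z≤n)))) (received-bound localId c∈C)) ⟩
  length C * (2 * m) ≡⟨ solve 2 (λ l m → l :* (con 2 :* m) := con 2 :* (m :* l)) refl (length C) m ⟩
  2 * (m * length C) ∎)
  where
    open ≤-Reasoning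
    m : ℕ
    m = 3 * n ∸ 2
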